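{- Let $T(n)=\sum_{k=0}^{n}\left[\binom{n+5k}{2n+2k}\binom{n}{k}\bmod 2\right]$ for $n\ge 0$. Let $(S(n))_{n\ge0}$ be defined by $S(0)=S(1)=S(2)=S(3)=1$ and $S(n)=S(n-1)+S(n-2)-S(n-3)+S(n-4)$ for $n\ge 4$ (i.e. $1,1,1,1,2,3,5,7,11,16,25,\dots$). Then $T$ is the run length transform of $S$.
   Context: For integers $a$ and $b\ge0$, $\binom{a}{b}=0$ whenever $a<b$ (in particular whenever $a<0$). $[x \bmod 2]$ denotes the residue in $\{0,1\}$. The run length transform of a sequence $(S(n))_{n\ge0}$ is $T(n)=\prod_{i\in\mathcal{L}(n)}S(i)$, where $\mathcal{L}(n)$ is the multiset of lengths of all maximal runs of $1$'s in the binary representation of $n$ (so $T(0)=1$). -}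

module Defs where

open import Data.Nat using (ℕ; zero; suc; _+_; _*_; _%_; _/_)
open import Data.Nat.Combinatorics using (_C_)
open import Data.Integer as ℤ using (ℤ; +_)
open import Data.List using (List; []; _∷_; map; upTo; foldr)
open import Data.Nat.ListAction using (sum)

-- T(n) = Σ_{k=0}^{n} [ C(n+5k, 2n+2k) * C(n,k) mod 2 ]
-- (stdlib's  n C k  is 0 when k > n, matching the paper's convention)
T : ℕ → ℕ
T n = sum (map (λ k → (((n + 5 * k) C (2 * n + 2 * k)) * (n C k)) % 2) (upTo (suc n)))

S : ℕ → ℤ
S 0 = + 1
S 1 = + 1
S 2 = + 1
S 3 = + 1
S (suc (suc (suc (suc n)))) =
  S (suc (suc (suc n))) ℤ.+ S (suc (suc n)) ℤ.- S (suc n) ℤ.+ S n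

-- runLengths n : lengths of the maximal runs of 1's in the binary representation
-- of n (listed from the least significant end).  Computed by scanning the bits
-- from the least significant one; 'fuel' bounds the number of bits (≥ n suffices),
-- 'r' is the length of the run of 1's currently being read.
runsAux : ℕ → ℕ → ℕ → List ℕ

closeRun : ℕ → List ℕ → List ℕ
closeRun zero    xs = xs
closeRun (suc k) xs = suc k ∷ xs

runsAux zero    m       r = closeRun r []
runsAux (suc f) zero    r = closeRun r []
runsAux (suc f) (suc m) r with (suc m) % 2
... | zero  = closeRun r (runsAux f ((suc m) / 2) 0)
... | suc _ = runsAux f ((suc m) / 2) (suc r)

runLengths : ℕ → List ℕ
runLengths n = runsAux n n 0

runLengthTransform : (ℕ → ℤ) → ℕ → ℤ
runLengthTransform s n = foldr (λ i acc → s i ℤ.* acc) (+ 1) (runLengths n)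

-- Modulo 2, Lucas' theorem makes the binomial coefficients in T(n) depend only on binary digits. Splitting off
-- the lowest digits of n and k, the digits of n + 5k + c and 2n + 2k + d come with carries into the next
-- position, so the generalised sums T′ c d n (T′ 0 0 = T) satisfy a digit recursion expressing
-- T′ c d (2m + a) through the sums T′ c′ d′ m; from T′ 0 0 only eight carry states (c, d) are reachable.
-- Four linear relations among these states hold for every n, by the same recursion. With them, T obeys the
-- recursion on trailing binary digits that characterises the run length transform of S: appending 0, 01, 011
-- or 0111 does not change the value (as S(0) = S(1) = S(2) = S(3) = 1), and a trailing run of four 1's
-- satisfies the recurrence of S. Two functions with these properties agree, by induction on binary expansions.
module Submission where

open import Level using (0ℓ)
open import Function using (_∘_)
open import Data.Nat
  using (ℕ; zero; suc; _+_; _*_; _%_; _/_; ⌊_/2⌋; _≤_; z≤n; s≤s; s≤s⁻¹)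
open import Data.Nat.Properties
  using (+-comm; +-assoc; +-suc; +-identityʳ; *-zeroʳ; *-identityʳ; *-distribˡ-+; ≤-refl; ≤-trans; n<1+n; m≤m*n)
open import Data.Nat.DivMod
  using (%-distribˡ-+; %-distribˡ-*; m*n%n≡0; [m+kn]%n≡m%n; m*n/n≡m; m/n<m; +-distrib-/-∣ʳ)
open import Data.Nat.Divisibility using (divides-refl)
open import Data.Nat.Combinatorics using (_C_; nCk+nC[k+1]≡[n+1]C[k+1]; k>n⇒nCk≡0)
open import Data.Nat.Tactic.RingSolver using (solve-∀)
open import Data.Integer as ℤ using (ℤ; +_)
import Data.Integer.Properties as ℤ
import Data.Integer.Tactic.RingSolver as ℤ-Solver
open import Data.Fin as Fin using (toℕ)
open import Data.Digit using (Bit; Expansion; fromDigits; toDigits)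
open import Data.List using (List; []; _∷_; foldr; map; applyUpTo)
open import Data.Nat.ListAction using (sum)
open import Data.Product using (proj₁; proj₂)
open import Relation.Binary.Bundles using (Setoid)
import Relation.Binary.Reasoning.Setoid
open import Relation.Binary.PropositionalEquality

open import Defs

-- A characterisation of the run length transform of S

pattern 0ᵇ = Fin.zero
pattern 1ᵇ = Fin.suc Fin.zero

infixl 8 _·0 _·1 _·1^_

_·0 _·1 : ℕ → ℕ
n ·0 = n * 2
n ·1 = 1 + n * 2

_·1^_ : ℕ → ℕ → ℕ
n ·1^ zero  = n
n ·1^ suc k = n ·1 ·1^ k

digit-induction : (P : ℕ → Set) → P 0 → (∀ n → P n → P (n ·0)) → (∀ n → P n → P (n ·1)) →
                  ∀ n → P n
digit-induction P P0 P·0 P·1 n = subst P (proj₂ (toDigits 2 n)) (go (proj₁ (toDigits 2 n)))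
  where
  go : (ds : Expansion 2) → P (fromDigits ds)
  go []        = P0
  go (0ᵇ ∷ ds) = P·0 _ (go ds)
  go (1ᵇ ∷ ds) = P·1 _ (go ds)

recurrence : (ℕ → ℤ) → ℕ → ℤ
recurrence f r = f (3 + r) ℤ.+ f (2 + r) ℤ.- f (1 + r) ℤ.+ f r

recurrence-cong : ∀ f g r → f (3 + r) ≡ g (3 + r) → f (2 + r) ≡ g (2 + r) → f (1 + r) ≡ g (1 + r) →
                  f r ≡ g r → recurrence f r ≡ recurrence g r
recurrence-cong f g r p q u v = cong₂ ℤ._+_ (cong₂ ℤ._-_ (cong₂ ℤ._+_ p q) u) v

recurrence-cong-≗ : ∀ {f g} → (∀ i → f i ≡ g i) → ∀ r → recurrence f r ≡ recurrence g r
recurrence-cong-≗ {f} {g} f≗g r = recurrence-cong f g r (f≗g (3 + r)) (f≗g (2 + r)) (f≗g (1 + r)) (f≗g r)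

pos-recurrence : ∀ (f : ℕ → ℕ) r → f (4 + r) + f (1 + r) ≡ f (3 + r) + f (2 + r) + f r →
               + f (4 + r) ≡ recurrence (λ k → + f k) r
pos-recurrence f r eq = begin
  + f (4 + r)                                     ≡⟨ cancel (+ f (4 + r)) (+ f (1 + r)) ⟩
  (+ f (4 + r) ℤ.+ + f (1 + r)) ℤ.- + f (1 + r)   ≡⟨ cong (λ x → + x ℤ.- + f (1 + r)) eq ⟩
  + (f (3 + r) + f (2 + r) + f r) ℤ.- + f (1 + r) ≡⟨ swap (+ f (3 + r)) (+ f (2 + r)) (+ f r) (+ f (1 + r)) ⟩
  recurrence (λ k → + f k) r                      ∎
  where
  open ≡-Reasoning
  cancel : ∀ x y → x ≡ (x ℤ.+ y) ℤ.- y
  cancel = ℤ-Solver.solve-∀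
  swap : ∀ x y z w → (x ℤ.+ y ℤ.+ z) ℤ.- w ≡ x ℤ.+ y ℤ.- w ℤ.+ z
  swap = ℤ-Solver.solve-∀

record RunLengthRecurrence (f : ℕ → ℤ) : Set where
  field
    at-0          : f 0 ≡ + 1
    trailing-0    : ∀ n → f (n ·0) ≡ f n
    trailing-01   : ∀ n → f (n ·0 ·1) ≡ f n
    trailing-011  : ∀ n → f (n ·0 ·1 ·1) ≡ f n
    trailing-0111 : ∀ n → f (n ·0 ·1 ·1 ·1) ≡ f n
    trailing-1111 : ∀ n → f (n ·1 ·1 ·1 ·1) ≡ recurrence (λ k → f (n ·1^ k)) 0

RunLengthRecurrence-unique : ∀ {f g} → RunLengthRecurrence f → RunLengthRecurrence g → ∀ n → f n ≡ g n
RunLengthRecurrence-unique {f} {g} F G n =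
  subst (λ m → f m ≡ g m) (proj₂ (toDigits 2 n)) (agree (proj₁ (toDigits 2 n)))
  where
  module F = RunLengthRecurrence F
  module G = RunLengthRecurrence G

  along : (e : ℕ → ℕ) → (∀ m → f (e m) ≡ f m) → (∀ m → g (e m) ≡ g m) → ∀ {m} → f m ≡ g m →
          f (e m) ≡ g (e m)
  along e fe ge {m} f≡g = trans (fe m) (trans f≡g (sym (ge m)))

  agree : (ds : Expansion 2) → f (fromDigits ds) ≡ g (fromDigits ds)
  agree []                        = trans F.at-0 (sym G.at-0)
  agree (0ᵇ ∷ ds)                 = along _·0 F.trailing-0 G.trailing-0 (agree ds)
  agree (1ᵇ ∷ [])                 = along (_·1 ∘ _·0) F.trailing-01 G.trailing-01 (agree [])
  agree (1ᵇ ∷ 0ᵇ ∷ ds)            = along (_·1 ∘ _·0) F.trailing-01 G.trailing-01 (agree ds)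
  agree (1ᵇ ∷ 1ᵇ ∷ [])            = along (λ m → m ·0 ·1 ·1) F.trailing-011 G.trailing-011 (agree [])
  agree (1ᵇ ∷ 1ᵇ ∷ 0ᵇ ∷ ds)       = along (λ m → m ·0 ·1 ·1) F.trailing-011 G.trailing-011 (agree ds)
  agree (1ᵇ ∷ 1ᵇ ∷ 1ᵇ ∷ [])       = along (λ m → m ·0 ·1 ·1 ·1) F.trailing-0111 G.trailing-0111 (agree [])
  agree (1ᵇ ∷ 1ᵇ ∷ 1ᵇ ∷ 0ᵇ ∷ ds)  = along (λ m → m ·0 ·1 ·1 ·1) F.trailing-0111 G.trailing-0111 (agree ds)
  agree (1ᵇ ∷ 1ᵇ ∷ 1ᵇ ∷ 1ᵇ ∷ ds)  = begin
    f (m ·1 ·1 ·1 ·1)                   ≡⟨ F.trailing-1111 m ⟩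
    recurrence (λ k → f (m ·1^ k)) 0    ≡⟨ recurrence-cong (λ k → f (m ·1^ k)) (λ k → g (m ·1^ k)) 0
                                             (agree (1ᵇ ∷ 1ᵇ ∷ 1ᵇ ∷ ds)) (agree (1ᵇ ∷ 1ᵇ ∷ ds))
                                             (agree (1ᵇ ∷ ds)) (agree ds) ⟩
    recurrence (λ k → g (m ·1^ k)) 0    ≡⟨ G.trailing-1111 m ⟨
    g (m ·1 ·1 ·1 ·1)                   ∎
    where
    open ≡-Reasoning
    m = fromDigits ds

suc[m]/2≤ : ∀ {m h} → m ≤ h → suc m / 2 ≤ h
suc[m]/2≤ {m} m≤h = ≤-trans (s≤s⁻¹ (m/n<m (suc m) 2 (s≤s (s≤s z≤n)))) m≤h

runsAux-fuel : ∀ {f g} m r → m ≤ f → m ≤ g → runsAux f m r ≡ runsAux g m r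
runsAux-fuel {zero}  {zero}  zero r _ _ = refl
runsAux-fuel {zero}  {suc g} zero r _ _ = refl
runsAux-fuel {suc f} {zero}  zero r _ _ = refl
runsAux-fuel {suc f} {suc g} zero r _ _ = refl
runsAux-fuel {suc f} {suc g} (suc m) r (s≤s m≤f) (s≤s m≤g) with suc m % 2
... | zero  = cong (closeRun r) (runsAux-fuel (suc m / 2) 0 (suc[m]/2≤ m≤f) (suc[m]/2≤ m≤g))
... | suc _ = runsAux-fuel (suc m / 2) (suc r) (suc[m]/2≤ m≤f) (suc[m]/2≤ m≤g)

runsAux-even : ∀ f m r → suc m % 2 ≡ 0 → runsAux (suc f) (suc m) r ≡ closeRun r (runsAux f (suc m / 2) 0)
runsAux-even f m r even rewrite even = refl

runsAux-odd : ∀ f m r → suc m % 2 ≡ 1 → runsAux (suc f) (suc m) r ≡ runsAux f (suc m / 2) (suc r)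
runsAux-odd f m r odd rewrite odd = refl

-- The run lengths of n followed by r ones.
runsFrom : ℕ → ℕ → List ℕ
runsFrom n r = runsAux n n r

runsFrom-·1 : ∀ n r → runsFrom (n ·1) r ≡ runsFrom n (suc r)
runsFrom-·1 n r = begin
  runsAux (n ·1) (n ·1) r            ≡⟨ runsAux-odd (n * 2) (n * 2) r ([m+kn]%n≡m%n 1 n 2) ⟩
  runsAux (n * 2) (n ·1 / 2) (suc r) ≡⟨ cong (λ m → runsAux (n * 2) m (suc r)) [1+n*2]/2≡n ⟩
  runsAux (n * 2) n (suc r)          ≡⟨ runsAux-fuel n (suc r) (m≤m*n n 2) ≤-refl ⟩
  runsAux n n (suc r)                ∎
  where
  open ≡-Reasoning
  [1+n*2]/2≡n : n ·1 / 2 ≡ n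
  [1+n*2]/2≡n = trans (+-distrib-/-∣ʳ 1 {n * 2} {2} (divides-refl n)) (m*n/n≡m n 2)

runsFrom-·0 : ∀ n r → runsFrom (n ·0) r ≡ closeRun r (runsFrom n 0)
runsFrom-·0 zero    r = refl
runsFrom-·0 (suc n) r = begin
  runsAux (suc n ·0) (suc n ·0) r
    ≡⟨ runsAux-even (suc (n * 2)) (suc (n * 2)) r (m*n%n≡0 (suc n) 2) ⟩
  closeRun r (runsAux (suc (n * 2)) (suc n ·0 / 2) 0)
    ≡⟨ cong (λ m → closeRun r (runsAux (suc (n * 2)) m 0)) (m*n/n≡m (suc n) 2) ⟩
  closeRun r (runsAux (suc (n * 2)) (suc n) 0)
    ≡⟨ cong (closeRun r) (runsAux-fuel (suc n) 0 (s≤s (m≤m*n n 2)) ≤-refl) ⟩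
  closeRun r (runsAux (suc n) (suc n) 0)
    ∎
  where open ≡-Reasoning

module RunProduct (s : ℕ → ℤ) (s0≡1 : s 0 ≡ + 1) where

  product : List ℕ → ℤ
  product = foldr (λ i acc → s i ℤ.* acc) (+ 1)

  product-closeRun : ∀ r xs → product (closeRun r xs) ≡ s r ℤ.* product xs
  product-closeRun zero    xs = sym (trans (cong (ℤ._* product xs) s0≡1) (ℤ.*-identityˡ (product xs)))
  product-closeRun (suc r) xs = refl

  runProduct : ℕ → ℕ → ℤ
  runProduct n r = product (runsFrom n r)

  runProduct-0 : ∀ r → runProduct 0 r ≡ s r
  runProduct-0 r = trans (product-closeRun r []) (ℤ.*-identityʳ (s r))

  runProduct-·0 : ∀ n r → runProduct (n ·0) r ≡ s r ℤ.* runProduct n 0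
  runProduct-·0 n r = trans (cong product (runsFrom-·0 n r)) (product-closeRun r (runsFrom n 0))

  runProduct-·1 : ∀ n r → runProduct (n ·1) r ≡ runProduct n (suc r)
  runProduct-·1 n r = cong product (runsFrom-·1 n r)

  runProduct-·1^ : ∀ n k r → runProduct (n ·1^ k) r ≡ runProduct n (r + k)
  runProduct-·1^ n zero    r = cong (runProduct n) (sym (+-identityʳ r))
  runProduct-·1^ n (suc k) r = begin
    runProduct (n ·1 ·1^ k) r ≡⟨ runProduct-·1^ (n ·1) k r ⟩
    runProduct (n ·1) (r + k) ≡⟨ runProduct-·1 n (r + k) ⟩
    runProduct n (suc r + k)  ≡⟨ cong (runProduct n) (+-suc r k) ⟨
    runProduct n (r + suc k)  ∎
    where open ≡-Reasoning

  runProduct-·0·1^ : ∀ n k → runProduct (n ·0 ·1^ k) 0 ≡ s k ℤ.* runProduct n 0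
  runProduct-·0·1^ n k = trans (runProduct-·1^ (n ·0) k 0) (runProduct-·0 n k)

open RunProduct S refl using (runProduct; runProduct-0; runProduct-·0; runProduct-·1; runProduct-·1^; runProduct-·0·1^)

runProduct-recurrence : ∀ n r → runProduct n (4 + r) ≡ recurrence (runProduct n) r
runProduct-recurrence = digit-induction _ at-0 at-·0 at-·1
  where
  at-0 : ∀ r → runProduct 0 (4 + r) ≡ recurrence (runProduct 0) r
  at-0 r = trans (runProduct-0 (4 + r)) (sym (recurrence-cong-≗ runProduct-0 r))

  recurrence-*ʳ : ∀ a b c d x → (a ℤ.+ b ℤ.- c ℤ.+ d) ℤ.* x ≡ a ℤ.* x ℤ.+ b ℤ.* x ℤ.- c ℤ.* x ℤ.+ d ℤ.* x
  recurrence-*ʳ = ℤ-Solver.solve-∀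

  at-·0 : ∀ n → (∀ r → runProduct n (4 + r) ≡ recurrence (runProduct n) r) →
          ∀ r → runProduct (n ·0) (4 + r) ≡ recurrence (runProduct (n ·0)) r
  at-·0 n _ r = let x = runProduct n 0 in begin
    runProduct (n ·0) (4 + r)               ≡⟨ runProduct-·0 n (4 + r) ⟩
    recurrence S r ℤ.* x                    ≡⟨ recurrence-*ʳ (S (3 + r)) (S (2 + r)) (S (1 + r)) (S r) x ⟩
    recurrence (λ i → S i ℤ.* x) r          ≡⟨ recurrence-cong-≗ (runProduct-·0 n) r ⟨
    recurrence (runProduct (n ·0)) r        ∎
    where open ≡-Reasoning

  at-·1 : ∀ n → (∀ r → runProduct n (4 + r) ≡ recurrence (runProduct n) r) →
          ∀ r → runProduct (n ·1) (4 + r) ≡ recurrence (runProduct (n ·1)) r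
  at-·1 n ih r = begin
    runProduct (n ·1) (4 + r)               ≡⟨ runProduct-·1 n (4 + r) ⟩
    runProduct n (4 + suc r)                ≡⟨ ih (suc r) ⟩
    recurrence (runProduct n) (suc r)       ≡⟨ recurrence-cong-≗ (runProduct-·1 n) r ⟨
    recurrence (runProduct (n ·1)) r        ∎
    where open ≡-Reasoning

runLengthTransform-recurrence : RunLengthRecurrence (runLengthTransform S)
runLengthTransform-recurrence = record
  { at-0          = refl
  ; trailing-0    = λ n → trans (runProduct-·0·1^ n 0) (ℤ.*-identityˡ _)
  ; trailing-01   = λ n → trans (runProduct-·0·1^ n 1) (ℤ.*-identityˡ _)
  ; trailing-011  = λ n → trans (runProduct-·0·1^ n 2) (ℤ.*-identityˡ _)
  ; trailing-0111 = λ n → trans (runProduct-·0·1^ n 3) (ℤ.*-identityˡ _)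
  ; trailing-1111 = λ n → begin
      runProduct (n ·1^ 4) 0                    ≡⟨ runProduct-·1^ n 4 0 ⟩
      runProduct n 4                            ≡⟨ runProduct-recurrence n 0 ⟩
      recurrence (runProduct n) 0                 ≡⟨ recurrence-cong-≗ (λ k → runProduct-·1^ n k 0) 0 ⟨
      recurrence (λ k → runProduct (n ·1^ k) 0) 0 ∎
  }
  where open ≡-Reasoning

-- Binomial coefficients modulo 2

infix 4 _≡₂_
record _≡₂_ (a b : ℕ) : Set where
  constructor mk
  field parity : a % 2 ≡ b % 2
open _≡₂_

≡₂-setoid : Setoid 0ℓ 0ℓ
≡₂-setoid = record
  { Carrier = ℕ
  ; _≈_ = _≡₂_
  ; isEquivalence = record
    { refl = mk refl
    ; sym = λ (mk p) → mk (sym p)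
    ; trans = λ (mk p) (mk q) → mk (trans p q)
    }
  }

open Setoid ≡₂-setoid using () renaming (trans to ≡₂-trans)

≡⇒≡₂ : ∀ {a b} → a ≡ b → a ≡₂ b
≡⇒≡₂ = mk ∘ cong (_% 2)

module ≡₂-Reasoning = Relation.Binary.Reasoning.Setoid ≡₂-setoid

+-cong-≡₂ : ∀ {a a′ b b′} → a ≡₂ a′ → b ≡₂ b′ → a + b ≡₂ a′ + b′
+-cong-≡₂ {a} {a′} {b} {b′} (mk p) (mk q) = mk (begin
  (a + b) % 2             ≡⟨ %-distribˡ-+ a b 2 ⟩
  (a % 2 + b % 2) % 2     ≡⟨ cong₂ (λ x y → (x + y) % 2) p q ⟩
  (a′ % 2 + b′ % 2) % 2   ≡⟨ %-distribˡ-+ a′ b′ 2 ⟨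
  (a′ + b′) % 2           ∎)
  where open ≡-Reasoning

*-cong-≡₂ : ∀ {a a′ b b′} → a ≡₂ a′ → b ≡₂ b′ → a * b ≡₂ a′ * b′
*-cong-≡₂ {a} {a′} {b} {b′} (mk p) (mk q) = mk (begin
  (a * b) % 2             ≡⟨ %-distribˡ-* a b 2 ⟩
  (a % 2 * (b % 2)) % 2   ≡⟨ cong₂ (λ x y → (x * y) % 2) p q ⟩
  (a′ % 2 * (b′ % 2)) % 2 ≡⟨ %-distribˡ-* a′ b′ 2 ⟨
  (a′ * b′) % 2           ∎)
  where open ≡-Reasoning

x+x≡₂0 : ∀ x → x + x ≡₂ 0
x+x≡₂0 x = mk (trans (cong (_% 2) (x+x≡x*2 x)) (m*n%n≡0 x 2))
  where
  x+x≡x*2 : ∀ x → x + x ≡ x * 2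
  x+x≡x*2 = solve-∀

pascal : ∀ n k → suc n C suc k ≡ n C k + n C suc k
pascal n k = sym (nCk+nC[k+1]≡[n+1]C[k+1] n k)

module _ where
  open ≡₂-Reasoning

  mutual
    C-even-even : ∀ X Y → (X * 2) C (Y * 2) ≡₂ X C Y
    C-even-even zero    zero    = mk refl
    C-even-even zero    (suc Y) = mk refl
    C-even-even (suc X) zero    = mk refl
    C-even-even (suc X) (suc Y) = begin
      suc (suc (X * 2)) C suc (suc (Y * 2))                ≡⟨ pascal (suc (X * 2)) (suc (Y * 2)) ⟩
      suc (X * 2) C suc (Y * 2) + suc (X * 2) C (suc Y * 2) ≈⟨ +-cong-≡₂ (C-odd-odd X Y) (C-odd-even X (suc Y)) ⟩
      X C Y + X C suc Y                                     ≡⟨ pascal X Y ⟨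
      suc X C suc Y                                         ∎

    C-even-odd : ∀ X Y → (X * 2) C suc (Y * 2) ≡₂ 0
    C-even-odd zero    Y = mk refl
    C-even-odd (suc X) Y = begin
      suc (suc (X * 2)) C suc (Y * 2)              ≡⟨ pascal (suc (X * 2)) (Y * 2) ⟩
      suc (X * 2) C (Y * 2) + suc (X * 2) C suc (Y * 2) ≈⟨ +-cong-≡₂ (C-odd-even X Y) (C-odd-odd X Y) ⟩
      X C Y + X C Y                                ≈⟨ x+x≡₂0 (X C Y) ⟩
      0                                            ∎

    C-odd-odd : ∀ X Y → suc (X * 2) C suc (Y * 2) ≡₂ X C Y
    C-odd-odd X Y = begin
      suc (X * 2) C suc (Y * 2)            ≡⟨ pascal (X * 2) (Y * 2) ⟩
      (X * 2) C (Y * 2) + (X * 2) C suc (Y * 2) ≈⟨ +-cong-≡₂ (C-even-even X Y) (C-even-odd X Y) ⟩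
      X C Y + 0                            ≡⟨ +-identityʳ (X C Y) ⟩
      X C Y                                ∎

    C-odd-even : ∀ X Y → suc (X * 2) C (Y * 2) ≡₂ X C Y
    C-odd-even X zero    = mk refl
    C-odd-even X (suc Y) = begin
      suc (X * 2) C suc (suc (Y * 2))            ≡⟨ pascal (X * 2) (suc (Y * 2)) ⟩
      (X * 2) C suc (Y * 2) + (X * 2) C (suc Y * 2) ≈⟨ +-cong-≡₂ (C-even-odd X Y) (C-even-even X (suc Y)) ⟩
      0 + X C suc Y                              ∎

lucas₂ : (r s : Bit) (X Y : ℕ) → (toℕ r + X * 2) C (toℕ s + Y * 2) ≡₂ (X C Y) * (toℕ r C toℕ s)
lucas₂ 0ᵇ 0ᵇ X Y = ≡₂-trans (C-even-even X Y) (≡⇒≡₂ (sym (*-identityʳ (X C Y))))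
lucas₂ 0ᵇ 1ᵇ X Y = ≡₂-trans (C-even-odd X Y) (≡⇒≡₂ (sym (*-zeroʳ (X C Y))))
lucas₂ 1ᵇ 0ᵇ X Y = ≡₂-trans (C-odd-even X Y) (≡⇒≡₂ (sym (*-identityʳ (X C Y))))
lucas₂ 1ᵇ 1ᵇ X Y = ≡₂-trans (C-odd-odd X Y) (≡⇒≡₂ (sym (*-identityʳ (X C Y))))

∑ : ℕ → (ℕ → ℕ) → ℕ
∑ zero    f = 0
∑ (suc n) f = f 0 + ∑ n (λ k → f (suc k))

syntax ∑ n (λ k → e) = ∑[ k < n ] e

∑-cong : ∀ {f g} n → (∀ k → f k ≡ g k) → ∑ n f ≡ ∑ n g
∑-cong zero    f≗g = refl
∑-cong (suc n) f≗g = cong₂ _+_ (f≗g 0) (∑-cong n (λ k → f≗g (suc k)))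

∑-+ : ∀ f g n → ∑[ k < n ] (f k + g k) ≡ ∑ n f + ∑ n g
∑-+ f g zero    = refl
∑-+ f g (suc n) = begin
  (f 0 + g 0) + ∑[ k < n ] (f (suc k) + g (suc k)) ≡⟨ cong (_+_ (f 0 + g 0)) (∑-+ _ _ n) ⟩
  (f 0 + g 0) + (F + G)                             ≡⟨ interchange (f 0) (g 0) F G ⟩
  (f 0 + F) + (g 0 + G)                             ∎
  where
  open ≡-Reasoning
  F = ∑[ k < n ] f (suc k)
  G = ∑[ k < n ] g (suc k)
  interchange : ∀ a b c d → (a + b) + (c + d) ≡ (a + c) + (b + d)
  interchange = solve-∀

∑-*ˡ : ∀ c f n → ∑[ k < n ] (c * f k) ≡ c * ∑ n f
∑-*ˡ c f zero    = sym (*-zeroʳ c)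
∑-*ˡ c f (suc n) = trans (cong (_+_ (c * f 0)) (∑-*ˡ c _ n)) (sym (*-distribˡ-+ c (f 0) _))

∑-suc : ∀ f n → ∑ (suc n) f ≡ ∑ n f + f n
∑-suc f zero    = +-identityʳ (f 0)
∑-suc f (suc n) = trans (cong (_+_ (f 0)) (∑-suc _ n)) (sym (+-assoc (f 0) _ _))

∑-pairs : ∀ f n → ∑ (n * 2) f ≡ ∑[ j < n ] (f (j * 2) + f (suc (j * 2)))
∑-pairs f zero    = refl
∑-pairs f (suc n) =
  trans (sym (+-assoc (f 0) (f 1) _)) (cong (_+_ (f 0 + f 1)) (∑-pairs (λ k → f (suc (suc k))) n))

sum-map-applyUpTo : ∀ (g f : ℕ → ℕ) n → sum (map g (applyUpTo f n)) ≡ ∑[ k < n ] g (f k)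
sum-map-applyUpTo g f zero    = refl
sum-map-applyUpTo g f (suc n) = cong (_+_ (g (f 0))) (sum-map-applyUpTo g _ n)

-- The carry states of T

term : ℕ → ℕ → ℕ → ℕ → ℕ
term c d n k = (((c + (n + 5 * k)) C (d + (2 * n + 2 * k))) * (n C k)) % 2

T′ : ℕ → ℕ → ℕ → ℕ
T′ c d n = ∑[ k < suc n ] term c d n k

T≡T′00 : ∀ n → T n ≡ T′ 0 0 n
T≡T′00 n = sum-map-applyUpTo (term 0 0 n) (λ k → k) (suc n)

C-bits≤1 : (r s : Bit) → toℕ r C toℕ s ≤ 1
C-bits≤1 0ᵇ 0ᵇ = s≤s z≤n
C-bits≤1 0ᵇ 1ᵇ = z≤n
C-bits≤1 1ᵇ 0ᵇ = s≤s z≤n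
C-bits≤1 1ᵇ 1ᵇ = s≤s z≤n

*-bits-%2 : ∀ {u v} X Y → u ≤ 1 → v ≤ 1 → (X * u * (Y * v)) % 2 ≡ u * v * ((X * Y) % 2)
*-bits-%2 X Y z≤n       _         rewrite *-zeroʳ X = refl
*-bits-%2 X Y (s≤s z≤n) z≤n       rewrite *-zeroʳ Y | *-zeroʳ (X * 1) = refl
*-bits-%2 X Y (s≤s z≤n) (s≤s z≤n) rewrite *-identityʳ X | *-identityʳ Y = sym (+-identityʳ _)

lowBit : ℕ → Bit
lowBit zero          = 0ᵇ
lowBit (suc zero)    = 1ᵇ
lowBit (suc (suc n)) = lowBit n

lowBit+⌊n/2⌋*2≡n : ∀ n → toℕ (lowBit n) + ⌊ n /2⌋ * 2 ≡ n
lowBit+⌊n/2⌋*2≡n zero          = refl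
lowBit+⌊n/2⌋*2≡n (suc zero)    = refl
lowBit+⌊n/2⌋*2≡n (suc (suc n)) = begin
  toℕ (lowBit n) + suc (suc (⌊ n /2⌋ * 2)) ≡⟨ +-suc _ _ ⟩
  suc (toℕ (lowBit n) + suc (⌊ n /2⌋ * 2)) ≡⟨ cong suc (+-suc _ _) ⟩
  suc (suc (toℕ (lowBit n) + ⌊ n /2⌋ * 2)) ≡⟨ cong (suc ∘ suc) (lowBit+⌊n/2⌋*2≡n n) ⟩
  suc (suc n)                              ∎
  where open ≡-Reasoning

-- If n and k end in the digits a and b, then n + 5k + c and 2n + 2k + d end in the digits of top a b c and
-- bot a b d, and halving these gives the carries into the next position.
top bot : Bit → Bit → ℕ → ℕ
top a b c = c + (toℕ a + 5 * toℕ b)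
bot a b d = d + (2 * toℕ a + 2 * toℕ b)

weight : Bit → Bit → ℕ → ℕ → ℕ
weight a b c d = (toℕ (lowBit (top a b c)) C toℕ (lowBit (bot a b d))) * (toℕ a C toℕ b)

term-digit : ∀ a b c d m j →
  term c d (toℕ a + m * 2) (toℕ b + j * 2) ≡ weight a b c d * term ⌊ top a b c /2⌋ ⌊ bot a b d /2⌋ m j
term-digit a b c d m j = begin
  term c d (toℕ a + m * 2) (toℕ b + j * 2)
    ≡⟨ cong₂ (λ t u → ((t C u) * ((toℕ a + m * 2) C (toℕ b + j * 2))) % 2) top-digits bot-digits ⟩
  (((toℕ x₂ + (⌊ x /2⌋ + (m + 5 * j)) * 2) C (toℕ y₂ + (⌊ y /2⌋ + (2 * m + 2 * j)) * 2))
      * ((toℕ a + m * 2) C (toℕ b + j * 2))) % 2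
    ≡⟨ parity (*-cong-≡₂ (lucas₂ x₂ y₂ X Y) (lucas₂ a b m j)) ⟩
  ((X C Y) * u * ((m C j) * v)) % 2
    ≡⟨ *-bits-%2 (X C Y) (m C j) (C-bits≤1 x₂ y₂) (C-bits≤1 a b) ⟩
  u * v * term ⌊ x /2⌋ ⌊ y /2⌋ m j ∎
  where
  open ≡-Reasoning
  x = top a b c
  y = bot a b d
  x₂ = lowBit x
  y₂ = lowBit y
  X = ⌊ x /2⌋ + (m + 5 * j)
  Y = ⌊ y /2⌋ + (2 * m + 2 * j)
  u = toℕ x₂ C toℕ y₂
  v = toℕ a C toℕ b
  regroup : ∀ r q s → (r + q * 2) + s * 2 ≡ r + (q + s) * 2
  regroup = solve-∀
  top-split : ∀ c A B m j → c + ((A + m * 2) + 5 * (B + j * 2)) ≡ (c + (A + 5 * B)) + (m + 5 * j) * 2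
  top-split = solve-∀
  bot-split : ∀ d A B m j → d + (2 * (A + m * 2) + 2 * (B + j * 2)) ≡ (d + (2 * A + 2 * B)) + (2 * m + 2 * j) * 2
  bot-split = solve-∀
  top-digits : c + ((toℕ a + m * 2) + 5 * (toℕ b + j * 2)) ≡ toℕ x₂ + X * 2
  top-digits = begin
    c + ((toℕ a + m * 2) + 5 * (toℕ b + j * 2)) ≡⟨ top-split c (toℕ a) (toℕ b) m j ⟩
    x + (m + 5 * j) * 2                          ≡⟨ cong (_+ (m + 5 * j) * 2) (sym (lowBit+⌊n/2⌋*2≡n x)) ⟩
    (toℕ x₂ + ⌊ x /2⌋ * 2) + (m + 5 * j) * 2       ≡⟨ regroup (toℕ x₂) (⌊ x /2⌋) (m + 5 * j) ⟩
    toℕ x₂ + X * 2                               ∎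
  bot-digits : d + (2 * (toℕ a + m * 2) + 2 * (toℕ b + j * 2)) ≡ toℕ y₂ + Y * 2
  bot-digits = begin
    d + (2 * (toℕ a + m * 2) + 2 * (toℕ b + j * 2)) ≡⟨ bot-split d (toℕ a) (toℕ b) m j ⟩
    y + (2 * m + 2 * j) * 2                          ≡⟨ cong (_+ (2 * m + 2 * j) * 2) (sym (lowBit+⌊n/2⌋*2≡n y)) ⟩
    (toℕ y₂ + ⌊ y /2⌋ * 2) + (2 * m + 2 * j) * 2       ≡⟨ regroup (toℕ y₂) (⌊ y /2⌋) (2 * m + 2 * j) ⟩
    toℕ y₂ + Y * 2                                   ∎

term-vanishes : ∀ c d n → term c d n (suc n) ≡ 0
term-vanishes c d n =
  trans (cong (λ x → (A * x) % 2) (k>n⇒nCk≡0 (n<1+n n))) (cong (_% 2) (*-zeroʳ A))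
  where A = (c + (n + 5 * suc n)) C (d + (2 * n + 2 * suc n))

T′-pairs : ∀ (a : Bit) c d m → T′ c d (toℕ a + m * 2) ≡ ∑ (suc m * 2) (term c d (toℕ a + m * 2))
T′-pairs 1ᵇ c d m = refl
T′-pairs 0ᵇ c d m = sym (begin
  ∑ (suc (suc (m * 2))) f   ≡⟨ ∑-suc f (suc (m * 2)) ⟩
  ∑ (suc (m * 2)) f + f (suc (m * 2)) ≡⟨ cong (_+_ (∑ (suc (m * 2)) f)) (term-vanishes c d (m * 2)) ⟩
  ∑ (suc (m * 2)) f + 0     ≡⟨ +-identityʳ _ ⟩
  ∑ (suc (m * 2)) f         ∎)
  where
  open ≡-Reasoning
  f = term c d (m * 2)

T′-digit : ∀ (a : Bit) c d m →
  T′ c d (toℕ a + m * 2) ≡ weight a 0ᵇ c d * T′ ⌊ top a 0ᵇ c /2⌋ ⌊ bot a 0ᵇ d /2⌋ m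
                         + weight a 1ᵇ c d * T′ ⌊ top a 1ᵇ c /2⌋ ⌊ bot a 1ᵇ d /2⌋ m
T′-digit a c d m = begin
  T′ c d n
    ≡⟨ T′-pairs a c d m ⟩
  ∑ (suc m * 2) (term c d n)
    ≡⟨ ∑-pairs (term c d n) (suc m) ⟩
  ∑[ j < suc m ] (term c d n (j * 2) + term c d n (suc (j * 2)))
    ≡⟨ ∑-cong (suc m) (λ j → cong₂ _+_ (term-digit a 0ᵇ c d m j) (term-digit a 1ᵇ c d m j)) ⟩
  ∑[ j < suc m ] (w₀ * t₀ j + w₁ * t₁ j)
    ≡⟨ ∑-+ (λ j → w₀ * t₀ j) (λ j → w₁ * t₁ j) (suc m) ⟩
  ∑[ j < suc m ] (w₀ * t₀ j) + ∑[ j < suc m ] (w₁ * t₁ j)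
    ≡⟨ cong₂ _+_ (∑-*ˡ w₀ t₀ (suc m)) (∑-*ˡ w₁ t₁ (suc m)) ⟩
  w₀ * ∑ (suc m) t₀ + w₁ * ∑ (suc m) t₁
    ∎
  where
  open ≡-Reasoning
  n = toℕ a + m * 2
  w₀ = weight a 0ᵇ c d
  w₁ = weight a 1ᵇ c d
  t₀ = term ⌊ top a 0ᵇ c /2⌋ ⌊ bot a 0ᵇ d /2⌋ m
  t₁ = term ⌊ top a 1ᵇ c /2⌋ ⌊ bot a 1ᵇ d /2⌋ m

1x+0y≡x : ∀ x y → 1 * x + 0 * y ≡ x
1x+0y≡x = solve-∀

0x+1y≡y : ∀ x y → 0 * x + 1 * y ≡ y
0x+1y≡y = solve-∀

1x+1y≡x+y : ∀ x y → 1 * x + 1 * y ≡ x + y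
1x+1y≡x+y = solve-∀

0x+0y≡0 : ∀ x y → 0 * x + 0 * y ≡ 0
0x+0y≡0 = solve-∀

-- T′-digit at the eight carry states reachable from (0, 0); every weight evaluates to 0 or 1.
T′00·0 : ∀ m → T′ 0 0 (m ·0) ≡ T′ 0 0 m
T′00·0 m = trans (T′-digit 0ᵇ 0 0 m) (1x+0y≡x (T′ 0 0 m) (T′ 2 1 m))
T′00·1 : ∀ m → T′ 0 0 (m ·1) ≡ T′ 0 1 m + T′ 3 2 m
T′00·1 m = trans (T′-digit 1ᵇ 0 0 m) (1x+1y≡x+y (T′ 0 1 m) (T′ 3 2 m))
T′01·0 : ∀ m → T′ 0 1 (m ·0) ≡ 0
T′01·0 m = trans (T′-digit 0ᵇ 0 1 m) (0x+0y≡0 (T′ 0 0 m) (T′ 2 1 m))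
T′01·1 : ∀ m → T′ 0 1 (m ·1) ≡ T′ 0 1 m
T′01·1 m = trans (T′-digit 1ᵇ 0 1 m) (1x+0y≡x (T′ 0 1 m) (T′ 3 2 m))
T′11·0 : ∀ m → T′ 1 1 (m ·0) ≡ T′ 0 0 m
T′11·0 m = trans (T′-digit 0ᵇ 1 1 m) (1x+0y≡x (T′ 0 0 m) (T′ 3 1 m))
T′11·1 : ∀ m → T′ 1 1 (m ·1) ≡ T′ 3 2 m
T′11·1 m = trans (T′-digit 1ᵇ 1 1 m) (0x+1y≡y (T′ 1 1 m) (T′ 3 2 m))
T′12·0 : ∀ m → T′ 1 2 (m ·0) ≡ T′ 0 1 m
T′12·0 m = trans (T′-digit 0ᵇ 1 2 m) (1x+0y≡x (T′ 0 1 m) (T′ 3 2 m))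
T′12·1 : ∀ m → T′ 1 2 (m ·1) ≡ T′ 1 2 m + T′ 3 3 m
T′12·1 m = trans (T′-digit 1ᵇ 1 2 m) (1x+1y≡x+y (T′ 1 2 m) (T′ 3 3 m))
T′22·0 : ∀ m → T′ 2 2 (m ·0) ≡ T′ 1 1 m
T′22·0 m = trans (T′-digit 0ᵇ 2 2 m) (1x+0y≡x (T′ 1 1 m) (T′ 3 2 m))
T′22·1 : ∀ m → T′ 2 2 (m ·1) ≡ T′ 1 2 m + T′ 4 3 m
T′22·1 m = trans (T′-digit 1ᵇ 2 2 m) (1x+1y≡x+y (T′ 1 2 m) (T′ 4 3 m))
T′32·0 : ∀ m → T′ 3 2 (m ·0) ≡ T′ 1 1 m
T′32·0 m = trans (T′-digit 0ᵇ 3 2 m) (1x+0y≡x (T′ 1 1 m) (T′ 4 2 m))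
T′32·1 : ∀ m → T′ 3 2 (m ·1) ≡ T′ 2 2 m + T′ 4 3 m
T′32·1 m = trans (T′-digit 1ᵇ 3 2 m) (1x+1y≡x+y (T′ 2 2 m) (T′ 4 3 m))
T′33·0 : ∀ m → T′ 3 3 (m ·0) ≡ T′ 1 1 m
T′33·0 m = trans (T′-digit 0ᵇ 3 3 m) (1x+0y≡x (T′ 1 1 m) (T′ 4 2 m))
T′33·1 : ∀ m → T′ 3 3 (m ·1) ≡ T′ 4 3 m
T′33·1 m = trans (T′-digit 1ᵇ 3 3 m) (0x+1y≡y (T′ 2 2 m) (T′ 4 3 m))
T′43·0 : ∀ m → T′ 4 3 (m ·0) ≡ 0
T′43·0 m = trans (T′-digit 0ᵇ 4 3 m) (0x+0y≡0 (T′ 2 1 m) (T′ 4 2 m))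
T′43·1 : ∀ m → T′ 4 3 (m ·1) ≡ T′ 2 2 m
T′43·1 m = trans (T′-digit 1ᵇ 4 3 m) (1x+0y≡x (T′ 2 2 m) (T′ 5 3 m))

record Invariants (n : ℕ) : Set where
  field
    T′01≡0               : T′ 0 1 n ≡ 0
    T′11≡T′00            : T′ 1 1 n ≡ T′ 0 0 n
    T′32≡T′33+T′43       : T′ 3 2 n ≡ T′ 3 3 n + T′ 4 3 n
    T′12+2T′33≡T′00+T′22 : T′ 1 2 n + 2 * T′ 3 3 n ≡ T′ 0 0 n + T′ 2 2 n

open Invariants

invariants : ∀ n → Invariants n
invariants = digit-induction Invariants at-0 at-·0 at-·1
  where
  at-0 : Invariants 0
  at-0 = record { T′01≡0 = refl ; T′11≡T′00 = refl ; T′32≡T′33+T′43 = refl ; T′12+2T′33≡T′00+T′22 = refl }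

  at-·0 : ∀ m → Invariants m → Invariants (m ·0)
  at-·0 m I = record
    { T′01≡0               = T′01·0 m
    ; T′11≡T′00            = trans (T′11·0 m) (sym (T′00·0 m))
    ; T′32≡T′33+T′43       = begin
        T′ 3 2 (m ·0)                     ≡⟨ T′32·0 m ⟩
        T′ 1 1 m                          ≡⟨ +-identityʳ _ ⟨
        T′ 1 1 m + 0                      ≡⟨ cong₂ _+_ (T′33·0 m) (T′43·0 m) ⟨
        T′ 3 3 (m ·0) + T′ 4 3 (m ·0)     ∎
    ; T′12+2T′33≡T′00+T′22 = begin
        T′ 1 2 (m ·0) + 2 * T′ 3 3 (m ·0) ≡⟨ cong₂ (λ x y → x + 2 * y) (T′12·0 m) (T′33·0 m) ⟩
        T′ 0 1 m + 2 * T′ 1 1 m           ≡⟨ cong₂ (λ x y → x + 2 * y) (T′01≡0 I) (T′11≡T′00 I) ⟩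
        0 + 2 * T′ 0 0 m                  ≡⟨ 0+2x≡x+x (T′ 0 0 m) ⟩
        T′ 0 0 m + T′ 0 0 m               ≡⟨ cong₂ _+_ (T′00·0 m) (trans (T′22·0 m) (T′11≡T′00 I)) ⟨
        T′ 0 0 (m ·0) + T′ 2 2 (m ·0)     ∎
    }
    where
    open ≡-Reasoning
    0+2x≡x+x : ∀ x → 0 + 2 * x ≡ x + x
    0+2x≡x+x = solve-∀

  at-·1 : ∀ m → Invariants m → Invariants (m ·1)
  at-·1 m I = record
    { T′01≡0               = trans (T′01·1 m) (T′01≡0 I)
    ; T′11≡T′00            = begin
        T′ 1 1 (m ·1)                     ≡⟨ T′11·1 m ⟩
        T′ 3 2 m                          ≡⟨ cong (_+ T′ 3 2 m) (T′01≡0 I) ⟨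
        T′ 0 1 m + T′ 3 2 m               ≡⟨ T′00·1 m ⟨
        T′ 0 0 (m ·1)                     ∎
    ; T′32≡T′33+T′43       = begin
        T′ 3 2 (m ·1)                     ≡⟨ T′32·1 m ⟩
        T′ 2 2 m + T′ 4 3 m               ≡⟨ +-comm (T′ 2 2 m) (T′ 4 3 m) ⟩
        T′ 4 3 m + T′ 2 2 m               ≡⟨ cong₂ _+_ (T′33·1 m) (T′43·1 m) ⟨
        T′ 3 3 (m ·1) + T′ 4 3 (m ·1)     ∎
    ; T′12+2T′33≡T′00+T′22 = begin
        T′ 1 2 (m ·1) + 2 * T′ 3 3 (m ·1) ≡⟨ cong₂ (λ x y → x + 2 * y) (T′12·1 m) (T′33·1 m) ⟩
        T′ 1 2 m + T′ 3 3 m + 2 * T′ 4 3 m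
          ≡⟨ regroup (T′ 1 2 m) (T′ 3 3 m) (T′ 4 3 m) ⟩
        (0 + (T′ 3 3 m + T′ 4 3 m)) + (T′ 1 2 m + T′ 4 3 m)
          ≡⟨ cong₂ (λ x y → (x + y) + (T′ 1 2 m + T′ 4 3 m)) (T′01≡0 I) (T′32≡T′33+T′43 I) ⟨
        (T′ 0 1 m + T′ 3 2 m) + (T′ 1 2 m + T′ 4 3 m)
          ≡⟨ cong₂ _+_ (T′00·1 m) (T′22·1 m) ⟨
        T′ 0 0 (m ·1) + T′ 2 2 (m ·1)     ∎
    }
    where
    open ≡-Reasoning
    regroup : ∀ x y z → x + y + 2 * z ≡ (0 + (y + z)) + (x + z)
    regroup = solve-∀

T′00·1≡T′32 : ∀ m → T′ 0 0 (m ·1) ≡ T′ 3 2 m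
T′00·1≡T′32 m = trans (T′00·1 m) (cong (_+ T′ 3 2 m) (T′01≡0 (invariants m)))

T′00-trailing-01 : ∀ n → T′ 0 0 (n ·0 ·1) ≡ T′ 0 0 n
T′00-trailing-01 n = begin
  T′ 0 0 (n ·0 ·1)  ≡⟨ T′00·1≡T′32 (n ·0) ⟩
  T′ 3 2 (n ·0)     ≡⟨ T′32·0 n ⟩
  T′ 1 1 n          ≡⟨ T′11≡T′00 (invariants n) ⟩
  T′ 0 0 n          ∎
  where open ≡-Reasoning

T′00-trailing-011 : ∀ n → T′ 0 0 (n ·0 ·1 ·1) ≡ T′ 0 0 n
T′00-trailing-011 n = begin
  T′ 0 0 (n ·0 ·1 ·1)            ≡⟨ T′00·1≡T′32 (n ·0 ·1) ⟩
  T′ 3 2 (n ·0 ·1)               ≡⟨ T′32·1 (n ·0) ⟩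
  T′ 2 2 (n ·0) + T′ 4 3 (n ·0)  ≡⟨ cong₂ _+_ (T′22·0 n) (T′43·0 n) ⟩
  T′ 1 1 n + 0                   ≡⟨ +-identityʳ _ ⟩
  T′ 1 1 n                       ≡⟨ T′11≡T′00 (invariants n) ⟩
  T′ 0 0 n                       ∎
  where open ≡-Reasoning

T′00-trailing-0111 : ∀ n → T′ 0 0 (n ·0 ·1 ·1 ·1) ≡ T′ 0 0 n
T′00-trailing-0111 n = begin
  T′ 0 0 (n ·0 ·1 ·1 ·1)                               ≡⟨ T′00·1≡T′32 (n ·0 ·1 ·1) ⟩
  T′ 3 2 (n ·0 ·1 ·1)                                  ≡⟨ T′32·1 (n ·0 ·1) ⟩
  T′ 2 2 (n ·0 ·1) + T′ 4 3 (n ·0 ·1)                  ≡⟨ cong₂ _+_ (T′22·1 (n ·0)) (T′43·1 (n ·0)) ⟩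
  (T′ 1 2 (n ·0) + T′ 4 3 (n ·0)) + T′ 2 2 (n ·0)
    ≡⟨ cong₂ _+_ (cong₂ _+_ (trans (T′12·0 n) (T′01≡0 I)) (T′43·0 n)) (trans (T′22·0 n) (T′11≡T′00 I)) ⟩
  T′ 0 0 n                                             ∎
  where
  open ≡-Reasoning
  I = invariants n

T′00-trailing-1111 : ∀ t → T′ 0 0 (t ·1 ·1 ·1 ·1) + T′ 0 0 (t ·1)
                         ≡ T′ 0 0 (t ·1 ·1 ·1) + T′ 0 0 (t ·1 ·1) + T′ 0 0 t
T′00-trailing-1111 t = begin
  T′ 0 0 (t ·1 ·1 ·1 ·1) + T′ 0 0 (t ·1)
    ≡⟨ cong₂ _+_ t1111 t1 ⟩
  ((T′ 1 2 t + T′ 3 3 t) + T′ 2 2 t + (T′ 1 2 t + T′ 4 3 t)) + (T′ 3 3 t + T′ 4 3 t)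
    ≡⟨ regroup (T′ 1 2 t) (T′ 3 3 t) (T′ 2 2 t) (T′ 4 3 t) ⟩
  (T′ 1 2 t + 2 * T′ 3 3 t) + (T′ 1 2 t + 2 * T′ 4 3 t + T′ 2 2 t)
    ≡⟨ cong (_+ (T′ 1 2 t + 2 * T′ 4 3 t + T′ 2 2 t)) (T′12+2T′33≡T′00+T′22 (invariants t)) ⟩
  (T′ 0 0 t + T′ 2 2 t) + (T′ 1 2 t + 2 * T′ 4 3 t + T′ 2 2 t)
    ≡⟨ regroup′ (T′ 0 0 t) (T′ 1 2 t) (T′ 2 2 t) (T′ 4 3 t) ⟩
  ((T′ 1 2 t + T′ 4 3 t) + T′ 2 2 t) + (T′ 2 2 t + T′ 4 3 t) + T′ 0 0 t
    ≡⟨ cong₂ (λ x y → x + y + T′ 0 0 t) t111 t11 ⟨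
  T′ 0 0 (t ·1 ·1 ·1) + T′ 0 0 (t ·1 ·1) + T′ 0 0 t ∎
  where
  open ≡-Reasoning
  regroup : ∀ a b c d → ((a + b) + c + (a + d)) + (b + d) ≡ (a + 2 * b) + (a + 2 * d + c)
  regroup = solve-∀
  regroup′ : ∀ z a c d → (z + c) + (a + 2 * d + c) ≡ ((a + d) + c) + (c + d) + z
  regroup′ = solve-∀
  t1 : T′ 0 0 (t ·1) ≡ T′ 3 3 t + T′ 4 3 t
  t1 = trans (T′00·1≡T′32 t) (T′32≡T′33+T′43 (invariants t))
  t11 : T′ 0 0 (t ·1 ·1) ≡ T′ 2 2 t + T′ 4 3 t
  t11 = trans (T′00·1≡T′32 (t ·1)) (T′32·1 t)
  t111 : T′ 0 0 (t ·1 ·1 ·1) ≡ (T′ 1 2 t + T′ 4 3 t) + T′ 2 2 t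
  t111 = trans (T′00·1≡T′32 (t ·1 ·1)) (trans (T′32·1 (t ·1)) (cong₂ _+_ (T′22·1 t) (T′43·1 t)))
  t1111 : T′ 0 0 (t ·1 ·1 ·1 ·1) ≡ (T′ 1 2 t + T′ 3 3 t) + T′ 2 2 t + (T′ 1 2 t + T′ 4 3 t)
  t1111 = begin
    T′ 0 0 (t ·1 ·1 ·1 ·1)                  ≡⟨ T′00·1≡T′32 (t ·1 ·1 ·1) ⟩
    T′ 3 2 (t ·1 ·1 ·1)                     ≡⟨ T′32·1 (t ·1 ·1) ⟩
    T′ 2 2 (t ·1 ·1) + T′ 4 3 (t ·1 ·1)     ≡⟨ cong₂ _+_ (T′22·1 (t ·1)) (T′43·1 (t ·1)) ⟩
    (T′ 1 2 (t ·1) + T′ 4 3 (t ·1)) + T′ 2 2 (t ·1)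
      ≡⟨ cong₂ _+_ (cong₂ _+_ (T′12·1 t) (T′43·1 t)) (T′22·1 t) ⟩
    (T′ 1 2 t + T′ 3 3 t) + T′ 2 2 t + (T′ 1 2 t + T′ 4 3 t) ∎

T′00-recurrence : RunLengthRecurrence (λ n → + T′ 0 0 n)
T′00-recurrence = record
  { at-0          = refl
  ; trailing-0    = cong +_ ∘ T′00·0
  ; trailing-01   = cong +_ ∘ T′00-trailing-01
  ; trailing-011  = cong +_ ∘ T′00-trailing-011
  ; trailing-0111 = cong +_ ∘ T′00-trailing-0111
  ; trailing-1111 = λ n → pos-recurrence (λ k → T′ 0 0 (n ·1^ k)) 0 (T′00-trailing-1111 n)
  }

theorem10 : (n : ℕ) → + (T n) ≡ runLengthTransform S n
theorem10 n = begin
  + T n                  ≡⟨ cong +_ (T≡T′00 n) ⟩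
  + T′ 0 0 n             ≡⟨ RunLengthRecurrence-unique T′00-recurrence runLengthTransform-recurrence n ⟩
  runLengthTransform S n ∎
  where open ≡-Reasoning
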